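{- Let $d\geq 15$ be odd. Then $s(d-10)\leq M_3(d)$.
   Context: Let $Q_n=\{0,1\}^n$ be the $n$-dimensional hypercube graph (vertices adjacent iff they differ in exactly one coordinate), with graph distance $d(x,y)$ equal to the number of coordinates in which $x,y$ differ. A $3$-snake in $Q_n$ is a path $(S_t)_{t=0}^T$ in $Q_n$ (consecutive $S_t,S_{t+1}$ adjacent) such that for all $t\geq 0$ and all $t'\in[t+3,T]$ one has $d(S_t,S_{t'})\geq 3$; $T$ is its length. $s(n)$ denotes the maximal length of a $3$-snake in $Q_n$. In $3$-neighbour bootstrap percolation on $Q_d$, given an initial infected set $A_0$, one sets $A_{t+1}=A_t\cup\{v : v \text{ has at least } 3 \text{ neighbours in } A_t\}$; $A_0$ percolates if $A_t=\{0,1\}^d$ for some $t$, the least such $t$ being its percolation time. $M_3(d)$ is the maximal percolation time over all percolating sets $A_0\subseteq\{0,1\}^d$. -}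

module Defs where

open import Data.Bool using (Bool; true; false; not; _∨_; if_then_else_)
open import Data.Nat using (ℕ; zero; suc; _+_; _*_; _≤_; _<_; _≤ᵇ_)
open import Data.Fin using (Fin)
open import Data.Vec using (Vec; []; _∷_; _[_]%=_)
open import Data.Product using (_×_; Σ; ∃)
open import Relation.Binary.PropositionalEquality using (_≡_)
open import Relation.Nullary using (¬_)

Vertex : ℕ → Set
Vertex n = Vec Bool n

dist : ∀ {n} → Vertex n → Vertex n → ℕ
dist []       []       = 0
dist (a ∷ x) (b ∷ y) = (if a Data.Bool.xor b then 1 else 0) + dist x y

Adjacent : ∀ {n} → Vertex n → Vertex n → Set
Adjacent x y = dist x y ≡ 1

-- A 3-snake of length T in Q_n: S t for t = 0..T (values beyond T are irrelevant)
Is3Snake : (n T : ℕ) → (ℕ → Vertex n) → Set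
Is3Snake n T S =
  (∀ t → t < T → Adjacent (S t) (S (suc t))) ×
  (∀ t t' → t + 3 ≤ t' → t' ≤ T → 3 ≤ dist (S t) (S t'))

-- s n ≡ m : m is the maximal length of a 3-snake in Q_n
IsMaxSnakeLength : ℕ → ℕ → Set
IsMaxSnakeLength n s =
  (Σ (ℕ → Vertex n) λ S → Is3Snake n s S) ×
  (∀ T (S : ℕ → Vertex n) → Is3Snake n T S → T ≤ s)

VSet : ℕ → Set
VSet d = Vertex d → Bool

countTrue : ∀ {n} → (Fin n → Bool) → ℕ
countTrue {zero}  f = 0
countTrue {suc n} f = (if f Data.Fin.zero then 1 else 0) + countTrue (λ i → f (Data.Fin.suc i))

flipAt : ∀ {d} → Vertex d → Fin d → Vertex d
flipAt v i = v [ i ]%= not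

infectedNbrs : ∀ {d} → VSet d → Vertex d → ℕ
infectedNbrs A v = countTrue (λ i → A (flipAt v i))

step : ∀ {d} → VSet d → VSet d
step A v = A v ∨ (3 ≤ᵇ infectedNbrs A v)

iter : ∀ {d} → ℕ → VSet d → VSet d
iter zero    A = A
iter (suc t) A = step (iter t A)

Full : ∀ {d} → VSet d → Set
Full A = ∀ v → A v ≡ true

IsPercTime : (d : ℕ) → VSet d → ℕ → Set
IsPercTime d A0 t = Full (iter t A0) × (∀ t' → t' < t → ¬ Full (iter t' A0))

-- M_3(d) ≡ m : m is the maximal percolation time over percolating sets in Q_d
IsMaxPercTime : ℕ → ℕ → Set
IsMaxPercTime d m =
  (Σ (VSet d) λ A0 → IsPercTime d A0 m) ×
  (∀ (A0 : VSet d) t → IsPercTime d A0 t → t ≤ m)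

-- Write Q_(10 + n) = Q_10 × Q_n and fix a 3-snake S 0, …, S T in Q_n. The initial set consists
-- of the rows {y} × Q_n for the "solid" vertices y of a fixed gadget on Q_10, two "rails"
-- {e₀, e₁} × snake, the vertex (0, S 0) and a "trigger" (e₀₂, S T). The rails give (0, S (u + 1))
-- two infected neighbours and (0, S u) is the third, so the infection crawls along the snake,
-- one step per time unit. Nothing else is infected meanwhile: the 3-snake condition gives every
-- vertex of Q_n at most two snake neighbours and keeps S u away from S 0, …, S (u − 2), and a
-- finite check on the gadget turns this into "every vertex outside the crawl has at most two
-- infected neighbours". When the crawl reaches S T the trigger fires, the row e₂₃ × Q_n fills up
-- along Hamming distance from S T, and a rank function on Q_10 certifies that all other rows
-- follow. So the set percolates, but not before time T, whence s(n) < M₃(10 + n) for n ≥ 3.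

module Submission where

open import Defs
open import Data.Bool using (Bool; true; false; not; _∧_; _∨_; _xor_; if_then_else_)
open import Data.Bool.Properties using (∧-identityʳ; ∨-zeroʳ; xor-comm; T-≡) renaming (_≟_ to _≟ᵇ_)
open import Data.Nat using (ℕ; zero; suc; _+_; _*_; _∸_; _≤_; _<_; _≤ᵇ_; _<ᵇ_; _≡ᵇ_; _≤?_; _<?_; z≤n; s≤s)
open import Data.Nat.Properties
open import Data.Nat.Induction using (<-rec)
open import Data.Nat.Tactic.RingSolver using (solve-∀)
open import Data.Fin using (Fin; zero; suc; _↑ˡ_; _↑ʳ_; #_) renaming (_≟_ to _≟ᶠ_)
open import Data.Fin.Properties using (↑ˡ-injective) renaming (0≢1+n to fzero≢fsuc; suc-injective to fsuc-injective)
open import Data.Vec using (Vec; []; _∷_; _++_; take; drop; replicate)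
open import Data.Vec.Properties using (≡-dec; take++drop≡id; ++-injectiveˡ; ++-injectiveʳ)
open import Data.Product using (∃; _×_; _,_; proj₁; proj₂)
open import Data.Sum using (_⊎_; inj₁; inj₂; [_,_]′)
import Data.Sum as Sum
open import Data.Empty using (⊥; ⊥-elim)
open import Function using (_∘_; Equivalence)
open import Relation.Binary.Definitions using (DecidableEquality; tri<; tri≈; tri>)
open import Relation.Binary.PropositionalEquality
open import Relation.Nullary using (¬_; Dec; yes; no; does; contradiction)
open import Relation.Nullary.Decidable using (dec-true)

∨-true : ∀ {a b} → a ∨ b ≡ true → a ≡ true ⊎ b ≡ true
∨-true {true} _ = inj₁ refl
∨-true {false} b = inj₂ b

∧-true : ∀ {a b} → a ≡ true → b ≡ true → a ∧ b ≡ true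
∧-true refl b = b

∧-true-left : ∀ {a b} → a ∧ b ≡ true → a ≡ true
∧-true-left {true} _ = refl

∧-true-right : ∀ {a b} → a ∧ b ≡ true → b ≡ true
∧-true-right {true} b = b

⇒-true : ∀ {a b} → (a ≡ true → b ≡ true) → not a ∨ b ≡ true
⇒-true {false} _ = refl
⇒-true {true} a⇒b = a⇒b refl

nand-true : ∀ {a b} → (a ≡ true → b ≡ true → ⊥) → not (a ∧ b) ≡ true
nand-true {false} _ = refl
nand-true {true} {false} _ = refl
nand-true {true} {true} ¬ab = ⊥-elim (¬ab refl refl)

≤ᵇ-sound : ∀ {m n} → (m ≤ᵇ n) ≡ true → m ≤ n
≤ᵇ-sound {m} {n} h = ≤ᵇ⇒≤ m n (Equivalence.from T-≡ h)

≤ᵇ-complete : ∀ {m n} → m ≤ n → (m ≤ᵇ n) ≡ true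
≤ᵇ-complete m≤n = Equivalence.to T-≡ (≤⇒≤ᵇ m≤n)

does-true : ∀ {P : Set} (p? : Dec P) → does p? ≡ true → P
does-true (yes p) _ = p

indicator : Bool → ℕ
indicator b = if b then 1 else 0

indicator-mono : ∀ {a b} → (a ≡ true → b ≡ true) → indicator a ≤ indicator b
indicator-mono {false} _ = z≤n
indicator-mono {true} a⇒b rewrite a⇒b refl = ≤-refl

countTrue-cong : ∀ {n} {f g : Fin n → Bool} → (∀ i → f i ≡ g i) → countTrue f ≡ countTrue g
countTrue-cong {zero} _ = refl
countTrue-cong {suc n} f≗g = cong₂ (λ a b → indicator a + b) (f≗g zero) (countTrue-cong (f≗g ∘ suc))

countTrue-mono : ∀ {n} {f g : Fin n → Bool} → (∀ i → f i ≡ true → g i ≡ true) → countTrue f ≤ countTrue g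
countTrue-mono {zero} _ = z≤n
countTrue-mono {suc n} f⊆g = +-mono-≤ (indicator-mono (f⊆g zero)) (countTrue-mono (f⊆g ∘ suc))

countTrue-none : ∀ {n} {f : Fin n → Bool} → (∀ i → f i ≡ false) → countTrue f ≡ 0
countTrue-none {zero} _ = refl
countTrue-none {suc n} none rewrite none zero = countTrue-none (none ∘ suc)

countTrue-≤1 : ∀ {n} {f : Fin n → Bool} → (∀ i j → f i ≡ true → f j ≡ true → i ≡ j) → countTrue f ≤ 1
countTrue-≤1 {zero} _ = z≤n
countTrue-≤1 {suc n} {f} unique with f zero in f0
... | true = ≤-reflexive (cong suc (countTrue-none others-false))
  where
  others-false : ∀ i → f (suc i) ≡ false
  others-false i with f (suc i) in fi
  ... | false = refl
  ... | true = ⊥-elim (fzero≢fsuc (unique zero (suc i) f0 fi))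
... | false = countTrue-≤1 (λ i j fi fj → fsuc-injective (unique (suc i) (suc j) fi fj))

remove : ∀ {n} → Fin n → (Fin n → Bool) → Fin n → Bool
remove i f j = f j ∧ not (does (j ≟ᶠ i))

countTrue-remove : ∀ {n} {f : Fin n → Bool} i → f i ≡ true → countTrue f ≡ suc (countTrue (remove i f))
countTrue-remove {f = f} zero fi rewrite fi = cong suc (countTrue-cong (λ j → sym (∧-identityʳ (f (suc j)))))
countTrue-remove {f = f} (suc i) fi
  rewrite countTrue-remove {f = f ∘ suc} i fi | ∧-identityʳ (f zero) = +-suc (indicator (f zero)) _

remove-true : ∀ {n} (f : Fin n → Bool) i j → remove i f j ≡ true → f j ≡ true × j ≢ i
remove-true f i j with f j | j ≟ᶠ i
... | true | no j≢i = λ _ → refl , j≢i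
... | true | yes _ = λ ()
... | false | _ = λ ()

remove-keep : ∀ {n} (f : Fin n → Bool) {i j} → f j ≡ true → j ≢ i → remove i f j ≡ true
remove-keep f {i} {j} fj j≢i with j ≟ᶠ i
... | yes j≡i = contradiction j≡i j≢i
... | no _ rewrite fj = refl

some-true : ∀ {n} (f : Fin n → Bool) → 1 ≤ countTrue f → ∃ λ i → f i ≡ true
some-true {suc n} f h with f zero in f0
... | true = zero , f0
... | false = let i , fi = some-true (f ∘ suc) h in suc i , fi

pick : ∀ {n} k (f : Fin n → Bool) → suc k ≤ countTrue f → ∃ λ i → f i ≡ true × k ≤ countTrue (remove i f)
pick k f h =
  let i , fi = some-true f (≤-trans (s≤s z≤n) h)
  in i , fi , ≤-pred (subst (suc k ≤_) (countTrue-remove i fi) h)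

record ThreeTrue {n} (f : Fin n → Bool) : Set where
  field
    i j k : Fin n
    fi : f i ≡ true
    fj : f j ≡ true
    fk : f k ≡ true
    i≢j : i ≢ j
    i≢k : i ≢ k
    j≢k : j ≢ k

3≤countTrue⇒threeTrue : ∀ {n} (f : Fin n → Bool) → 3 ≤ countTrue f → ThreeTrue f
3≤countTrue⇒threeTrue f h =
  let i , fi , h₁ = pick 2 f h
      j , fj , h₂ = pick 1 (remove i f) h₁
      k , fk , _ = pick 0 (remove j (remove i f)) h₂
      fj′ , j≢i = remove-true f i j fj
      fk₁ , k≢j = remove-true (remove i f) j k fk
      fk′ , k≢i = remove-true f i k fk₁
  in record { i = i ; j = j ; k = k ; fi = fi ; fj = fj′ ; fk = fk′
            ; i≢j = j≢i ∘ sym ; i≢k = k≢i ∘ sym ; j≢k = k≢j ∘ sym }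

threeTrue⇒3≤countTrue : ∀ {n} {f : Fin n → Bool} → ThreeTrue f → 3 ≤ countTrue f
threeTrue⇒3≤countTrue {f = f}
  record { i = i ; j = j ; k = k ; fi = fi ; fj = fj ; fk = fk ; i≢j = i≢j ; i≢k = i≢k ; j≢k = j≢k } =
  subst (3 ≤_) (sym (trans remove-i (cong suc (trans remove-j (cong suc remove-k))))) (s≤s (s≤s (s≤s z≤n)))
  where
  f′ f″ : Fin _ → Bool
  f′ = remove i f
  f″ = remove j f′
  remove-i : countTrue f ≡ suc (countTrue f′)
  remove-i = countTrue-remove i fi
  remove-j : countTrue f′ ≡ suc (countTrue f″)
  remove-j = countTrue-remove j (remove-keep f fj (i≢j ∘ sym))
  remove-k : countTrue f″ ≡ suc (countTrue (remove k f″))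
  remove-k = countTrue-remove k (remove-keep f′ (remove-keep f fk (i≢k ∘ sym)) (j≢k ∘ sym))

threeTrue-map : ∀ {m n} {f : Fin m → Bool} {g : Fin n → Bool} (h : Fin m → Fin n) →
  (∀ {i j} → h i ≡ h j → i ≡ j) → (∀ {i} → f i ≡ true → g (h i) ≡ true) → ThreeTrue f → ThreeTrue g
threeTrue-map h injective f⇒g three = record
  { i = h i ; j = h j ; k = h k ; fi = f⇒g fi ; fj = f⇒g fj ; fk = f⇒g fk
  ; i≢j = i≢j ∘ injective ; i≢k = i≢k ∘ injective ; j≢k = j≢k ∘ injective }
  where open ThreeTrue three

countTrue-++ : ∀ m {n} (f : Fin (m + n) → Bool) →
  countTrue f ≡ countTrue (λ i → f (i ↑ˡ n)) + countTrue (λ j → f (m ↑ʳ j))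
countTrue-++ zero f = refl
countTrue-++ (suc m) f =
  trans (cong (indicator (f zero) +_) (countTrue-++ m (f ∘ suc))) (sym (+-assoc (indicator (f zero)) _ _))

take-++ : ∀ {A : Set} {m n} (y : Vec A m) (x : Vec A n) → take m (y ++ x) ≡ y
take-++ {m = m} y x = ++-injectiveˡ (take m (y ++ x)) y (take++drop≡id m (y ++ x))

drop-++ : ∀ {A : Set} {m n} (y : Vec A m) (x : Vec A n) → drop m (y ++ x) ≡ x
drop-++ {m = m} y x = ++-injectiveʳ (take m (y ++ x)) y (take++drop≡id m (y ++ x))

++-split : ∀ {A : Set} m {n} {P : Vec A (m + n) → Set} → (∀ y x → P (y ++ x)) → ∀ v → P v
++-split m {P = P} h v = subst P (take++drop≡id m v) (h (take m v) (drop m v))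

flipAt-↑ˡ : ∀ {m n} (y : Vertex m) (x : Vertex n) i → flipAt (y ++ x) (i ↑ˡ n) ≡ flipAt y i ++ x
flipAt-↑ˡ (b ∷ y) x zero = refl
flipAt-↑ˡ (b ∷ y) x (suc i) = cong (b ∷_) (flipAt-↑ˡ y x i)

flipAt-↑ʳ : ∀ {m n} (y : Vertex m) (x : Vertex n) j → flipAt (y ++ x) (m ↑ʳ j) ≡ y ++ flipAt x j
flipAt-↑ʳ [] x j = refl
flipAt-↑ʳ (b ∷ y) x j = cong (b ∷_) (flipAt-↑ʳ y x j)

-- The hypercube

_≟ᵛ_ : ∀ {n} → DecidableEquality (Vertex n)
_≟ᵛ_ = ≡-dec _≟ᵇ_

adjacent-sym : ∀ {n} (x y : Vertex n) → Adjacent x y → Adjacent y x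
adjacent-sym x y xy = trans (dist-sym y x) xy
  where
  dist-sym : ∀ {n} (x y : Vertex n) → dist x y ≡ dist y x
  dist-sym [] [] = refl
  dist-sym (a ∷ x) (b ∷ y) rewrite xor-comm a b | dist-sym x y = refl

dist-refl : ∀ {n} (x : Vertex n) → dist x x ≡ 0
dist-refl [] = refl
dist-refl (true ∷ x) = dist-refl x
dist-refl (false ∷ x) = dist-refl x

dist≡0⇒≡ : ∀ {n} {x y : Vertex n} → dist x y ≡ 0 → x ≡ y
dist≡0⇒≡ {x = []} {[]} _ = refl
dist≡0⇒≡ {x = true ∷ x} {true ∷ y} e = cong (true ∷_) (dist≡0⇒≡ e)
dist≡0⇒≡ {x = false ∷ x} {false ∷ y} e = cong (false ∷_) (dist≡0⇒≡ e)

dist≤dim : ∀ {n} (x y : Vertex n) → dist x y ≤ n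
dist≤dim [] [] = z≤n
dist≤dim (a ∷ x) (b ∷ y) = +-mono-≤ (indicator≤1 (a xor b)) (dist≤dim x y)
  where
  indicator≤1 : ∀ b → indicator b ≤ 1
  indicator≤1 true = ≤-refl
  indicator≤1 false = z≤n

adjacent-flipAt : ∀ {n} (x : Vertex n) j → Adjacent x (flipAt x j)
adjacent-flipAt (true ∷ x) zero = cong suc (dist-refl x)
adjacent-flipAt (false ∷ x) zero = cong suc (dist-refl x)
adjacent-flipAt (true ∷ x) (suc j) = adjacent-flipAt x j
adjacent-flipAt (false ∷ x) (suc j) = adjacent-flipAt x j

flipAt-injective : ∀ {n} (x : Vertex n) {i j} → flipAt x i ≡ flipAt x j → i ≡ j
flipAt-injective (_ ∷ x) {zero} {zero} _ = refl
flipAt-injective (true ∷ x) {zero} {suc j} ()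
flipAt-injective (false ∷ x) {zero} {suc j} ()
flipAt-injective (true ∷ x) {suc i} {zero} ()
flipAt-injective (false ∷ x) {suc i} {zero} ()
flipAt-injective (_ ∷ x) {suc i} {suc j} e = cong suc (flipAt-injective x (cong Data.Vec.tail e))

adjacent⇒flipAt : ∀ {n} (x y : Vertex n) → Adjacent x y → ∃ λ j → flipAt x j ≡ y
adjacent⇒flipAt [] [] ()
adjacent⇒flipAt (true ∷ x) (false ∷ y) e = zero , cong (false ∷_) (dist≡0⇒≡ (suc-injective e))
adjacent⇒flipAt (false ∷ x) (true ∷ y) e = zero , cong (true ∷_) (dist≡0⇒≡ (suc-injective e))
adjacent⇒flipAt (true ∷ x) (true ∷ y) e = let j , p = adjacent⇒flipAt x y e in suc j , cong (true ∷_) p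
adjacent⇒flipAt (false ∷ x) (false ∷ y) e = let j , p = adjacent⇒flipAt x y e in suc j , cong (false ∷_) p

closer-neighbour : ∀ {n} (x p : Vertex n) {k} → dist x p ≡ suc k → ∃ λ j → dist (flipAt x j) p ≡ k
closer-neighbour [] [] ()
closer-neighbour (true ∷ x) (false ∷ p) e = zero , suc-injective e
closer-neighbour (false ∷ x) (true ∷ p) e = zero , suc-injective e
closer-neighbour (true ∷ x) (true ∷ p) e = let j , q = closer-neighbour x p e in suc j , q
closer-neighbour (false ∷ x) (false ∷ p) e = let j , q = closer-neighbour x p e in suc j , q

detour : ∀ {n} → Vertex n → Vertex n → Vertex n → ℕ
detour [] [] [] = 0
detour (a ∷ x) (b ∷ y) (c ∷ z) = indicator ((a xor b) ∧ (b xor c)) + detour x y z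

dist-detour : ∀ {n} (x y z : Vertex n) → dist x z + 2 * detour x y z ≡ dist x y + dist y z
dist-detour [] [] [] = refl
dist-detour (a ∷ x) (b ∷ y) (c ∷ z) = begin
  (ac + dist x z) + 2 * (abc + detour x y z)   ≡⟨ regroup ac (dist x z) abc (detour x y z) ⟩
  (ac + 2 * abc) + (dist x z + 2 * detour x y z) ≡⟨ cong₂ _+_ (coordinate a b c) (dist-detour x y z) ⟩
  (ab + bc) + (dist x y + dist y z)             ≡⟨ interchange ab bc (dist x y) (dist y z) ⟩
  (ab + dist x y) + (bc + dist y z)             ∎
  where
  open ≡-Reasoning
  ab = indicator (a xor b)
  bc = indicator (b xor c)
  ac = indicator (a xor c)
  abc = indicator ((a xor b) ∧ (b xor c))
  coordinate : ∀ a b c →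
    indicator (a xor c) + 2 * indicator ((a xor b) ∧ (b xor c)) ≡ indicator (a xor b) + indicator (b xor c)
  coordinate true true true = refl
  coordinate true true false = refl
  coordinate true false true = refl
  coordinate true false false = refl
  coordinate false true true = refl
  coordinate false true false = refl
  coordinate false false true = refl
  coordinate false false false = refl
  regroup : ∀ p q r s → (p + q) + 2 * (r + s) ≡ (p + 2 * r) + (q + 2 * s)
  regroup = solve-∀
  interchange : ∀ p q r s → (p + q) + (r + s) ≡ (p + r) + (q + s)
  interchange = solve-∀

dist-triangle : ∀ {n} (x y z : Vertex n) → dist x z ≤ dist x y + dist y z
dist-triangle x y z = subst (dist x z ≤_) (dist-detour x y z) (m≤m+n _ _)

no-triangle : ∀ {n} (x y z : Vertex n) → Adjacent x y → Adjacent y z → ¬ Adjacent x z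
no-triangle x y z xy yz xz = odd≢2 (detour x y z) (begin
  1 + 2 * detour x y z        ≡⟨ cong (λ d → d + 2 * detour x y z) (sym xz) ⟩
  dist x z + 2 * detour x y z ≡⟨ dist-detour x y z ⟩
  dist x y + dist y z         ≡⟨ cong₂ _+_ xy yz ⟩
  2                           ∎)
  where
  open ≡-Reasoning
  odd≢2 : ∀ k → 1 + 2 * k ≢ 2
  odd≢2 (suc k) e = m+1+n≢0 k (suc-injective (suc-injective e))

-- 3-snakes

gap-view : ∀ {u v} → u < v → v ≡ suc u ⊎ v ≡ suc (suc u) ⊎ u + 3 ≤ v
gap-view {zero} {suc zero} _ = inj₁ refl
gap-view {zero} {suc (suc zero)} _ = inj₂ (inj₁ refl)
gap-view {zero} {suc (suc (suc v))} _ = inj₂ (inj₂ (s≤s (s≤s (s≤s z≤n))))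
gap-view {suc u} {suc v} (s≤s u<v) with gap-view u<v
... | inj₁ e = inj₁ (cong suc e)
... | inj₂ (inj₁ e) = inj₂ (inj₁ (cong suc e))
... | inj₂ (inj₂ le) = inj₂ (inj₂ (s≤s le))

TwoApart : ℕ → ℕ → Set
TwoApart u v = v ≡ suc (suc u) ⊎ u ≡ suc (suc v)

no-three-pairwise-two-apart : ∀ {u v w} → TwoApart u v → TwoApart u w → ¬ TwoApart v w
no-three-pairwise-two-apart (inj₁ refl) (inj₁ refl) (inj₁ ())
no-three-pairwise-two-apart (inj₁ refl) (inj₁ refl) (inj₂ ())
no-three-pairwise-two-apart (inj₁ refl) (inj₂ refl) (inj₁ ())
no-three-pairwise-two-apart (inj₁ refl) (inj₂ refl) (inj₂ ())
no-three-pairwise-two-apart (inj₂ refl) (inj₁ refl) (inj₁ ())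
no-three-pairwise-two-apart (inj₂ refl) (inj₁ refl) (inj₂ ())
no-three-pairwise-two-apart (inj₂ refl) (inj₂ refl) (inj₁ ())
no-three-pairwise-two-apart (inj₂ refl) (inj₂ refl) (inj₂ ())

module Snake {n T : ℕ} (S : ℕ → Vertex n) (snake : Is3Snake n T S) where

  steps : ∀ t → t < T → Adjacent (S t) (S (suc t))
  steps = proj₁ snake

  near-not-far : ∀ t t' → dist (S t) (S t') ≤ 2 → t + 3 ≤ t' → t' ≤ T → ⊥
  near-not-far t t' near t+3≤t' t'≤T = ≤⇒≯ near (proj₂ snake t t' t+3≤t' t'≤T)

  adjacent⇒successive : ∀ {u v} → u < v → v ≤ T → Adjacent (S u) (S v) → v ≡ suc u
  adjacent⇒successive {u} {v} u<v v≤T adj with gap-view u<v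
  ... | inj₁ v≡1+u = v≡1+u
  ... | inj₂ (inj₁ refl) =
    ⊥-elim (no-triangle (S u) (S (suc u)) (S v) (steps u (≤-trans (n≤1+n _) v≤T)) (steps (suc u) v≤T) adj)
  ... | inj₂ (inj₂ u+3≤v) = ⊥-elim (near-not-far u v (≤-trans (≤-reflexive adj) (n≤1+n 1)) u+3≤v v≤T)

  common-neighbour⇒two-apart : ∀ x {u v} → Adjacent x (S u) → Adjacent x (S v) →
    u < v → v ≤ T → v ≡ suc (suc u)
  common-neighbour⇒two-apart x {u} {v} xu xv u<v v≤T with gap-view u<v
  ... | inj₁ refl = ⊥-elim (no-triangle (S u) x (S v) (adjacent-sym x (S u) xu) xv (steps u v≤T))
  ... | inj₂ (inj₁ v≡2+u) = v≡2+u
  ... | inj₂ (inj₂ u+3≤v) = ⊥-elim (near-not-far u v two-hops u+3≤v v≤T)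
    where
    two-hops : dist (S u) (S v) ≤ 2
    two-hops = ≤-trans (dist-triangle (S u) x (S v)) (≤-reflexive (cong₂ _+_ (adjacent-sym x (S u) xu) xv))

  distinct-common-neighbours⇒two-apart : ∀ x {u v} → Adjacent x (S u) → Adjacent x (S v) →
    u ≢ v → u ≤ T → v ≤ T → TwoApart u v
  distinct-common-neighbours⇒two-apart x {u} {v} xu xv u≢v u≤T v≤T with <-cmp u v
  ... | tri< u<v _ _ = inj₁ (common-neighbour⇒two-apart x xu xv u<v v≤T)
  ... | tri≈ _ u≡v _ = contradiction u≡v u≢v
  ... | tri> _ _ v<u = inj₂ (common-neighbour⇒two-apart x xv xu v<u u≤T)

  end-not-earlier : 3 ≤ T → ∀ {u} → u < T → S u ≢ S T
  end-not-earlier 3≤T {u} u<T Su≡ST with gap-view u<T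
  ... | inj₁ T≡1+u = 0≢1+n (begin
    0                  ≡⟨ sym (dist-refl (S u)) ⟩
    dist (S u) (S u)   ≡⟨ cong (dist (S u)) Su≡ST ⟩
    dist (S u) (S T)   ≡⟨ subst (λ t → Adjacent (S u) (S t)) (sym T≡1+u) (steps u u<T) ⟩
    1                  ∎)
    where open ≡-Reasoning
  ... | inj₂ (inj₂ u+3≤T) = near-not-far u T (≤-trans (≤-reflexive same) z≤n) u+3≤T ≤-refl
    where
    same : dist (S u) (S T) ≡ 0
    same = trans (cong (dist (S u)) (sym Su≡ST)) (dist-refl (S u))
  ... | inj₂ (inj₁ T≡2+u) with u
  ...   | zero = ≤⇒≯ (≤-reflexive T≡2+u) 3≤T
  ...   | suc u′ = near-not-far u′ T (≤-trans (≤-reflexive one-step) (n≤1+n 1)) u′+3≤T ≤-refl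
    where
    u′+3≤T : u′ + 3 ≤ T
    u′+3≤T = ≤-reflexive (trans (+-comm u′ 3) (sym T≡2+u))
    one-step : dist (S u′) (S T) ≡ 1
    one-step = trans (cong (dist (S u′)) (sym Su≡ST)) (steps u′ (≤-trans (n≤1+n _) u<T))

  onPrefix : ℕ → Vertex n → Bool
  onPrefix zero x = does (S zero ≟ᵛ x)
  onPrefix (suc t) x = onPrefix t x ∨ does (S (suc t) ≟ᵛ x)

  onPrefix-sound : ∀ t {x} → onPrefix t x ≡ true → ∃ λ u → u ≤ t × S u ≡ x
  onPrefix-sound zero {x} with S zero ≟ᵛ x
  ... | yes S0≡x = λ _ → zero , z≤n , S0≡x
  ... | no _ = λ ()
  onPrefix-sound (suc t) {x} with onPrefix t x in earlier | S (suc t) ≟ᵛ x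
  ... | true | _ = λ _ → let u , u≤t , Su≡x = onPrefix-sound t earlier in u , m≤n⇒m≤1+n u≤t , Su≡x
  ... | false | yes St≡x = λ _ → suc t , ≤-refl , St≡x
  ... | false | no _ = λ ()

  onPrefix-complete : ∀ u {t} → u ≤ t → onPrefix t (S u) ≡ true
  onPrefix-complete zero {zero} _ = dec-true (S zero ≟ᵛ S zero) refl
  onPrefix-complete u {suc t} u≤1+t with m≤n⇒m<n∨m≡n u≤1+t
  ... | inj₁ u<1+t rewrite onPrefix-complete u {t} (≤-pred u<1+t) = refl
  ... | inj₂ refl rewrite dec-true (S (suc t) ≟ᵛ S (suc t)) refl = ∨-zeroʳ _

  onPrefix-mono : ∀ {t t'} → t ≤ t' → ∀ x → onPrefix t x ≡ true → onPrefix t' x ≡ true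
  onPrefix-mono {t} t≤t' x on-t with onPrefix-sound t on-t
  ... | u , u≤t , refl = onPrefix-complete u (≤-trans u≤t t≤t')

  no-three-snake-neighbours : ∀ x → ¬ ThreeTrue (λ j → onPrefix T (flipAt x j))
  no-three-snake-neighbours x three =
    no-three-pairwise-two-apart (two-apart fi fj i≢j) (two-apart fi fk i≢k) (two-apart fj fk j≢k)
    where
    open ThreeTrue three
    time : ∀ {a} → onPrefix T (flipAt x a) ≡ true → ℕ
    time on = proj₁ (onPrefix-sound T on)
    two-apart : ∀ {a b} (on-a : onPrefix T (flipAt x a) ≡ true) (on-b : onPrefix T (flipAt x b) ≡ true) →
      a ≢ b → TwoApart (time on-a) (time on-b)
    two-apart {a} {b} on-a on-b a≢b with onPrefix-sound T on-a | onPrefix-sound T on-b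
    ... | u , u≤T , Su≡ | v , v≤T , Sv≡ =
      distinct-common-neighbours⇒two-apart x
        (subst (Adjacent x) (sym Su≡) (adjacent-flipAt x a))
        (subst (Adjacent x) (sym Sv≡) (adjacent-flipAt x b))
        (λ u≡v → a≢b (flipAt-injective x (trans (sym Su≡) (trans (cong S u≡v) Sv≡))))
        u≤T v≤T

  snake-neighbours≤2 : ∀ x → countTrue (λ j → onPrefix T (flipAt x j)) ≤ 2
  snake-neighbours≤2 x with countTrue (λ j → onPrefix T (flipAt x j)) ≤? 2
  ... | yes ≤2 = ≤2
  ... | no ≰2 = ⊥-elim (no-three-snake-neighbours x (3≤countTrue⇒threeTrue _ (≰⇒> ≰2)))

  later-vertex-off-prefix-neighbours : ∀ {t u} → suc (suc t) ≤ u → u ≤ T →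
    ∀ j → onPrefix t (flipAt (S u) j) ≡ false
  later-vertex-off-prefix-neighbours {t} {u} t+2≤u u≤T j with onPrefix t (flipAt (S u) j) in on
  ... | false = refl
  ... | true with onPrefix-sound t on
  ...   | v , v≤t , Sv≡ = ⊥-elim (1+n≰n (subst (suc (suc v) ≤_) u≡1+v v+2≤u))
    where
    v+2≤u : suc (suc v) ≤ u
    v+2≤u = ≤-trans (s≤s (s≤s v≤t)) t+2≤u
    u≡1+v : u ≡ suc v
    u≡1+v = adjacent⇒successive (≤-trans (n≤1+n _) v+2≤u) u≤T
      (adjacent-sym (S u) (S v) (subst (Adjacent (S u)) (sym Sv≡) (adjacent-flipAt (S u) j)))

three-step-path : ∀ k → ℕ → Vertex (3 + k)
three-step-path k 0 = false ∷ false ∷ false ∷ replicate k false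
three-step-path k 1 = true ∷ false ∷ false ∷ replicate k false
three-step-path k 2 = true ∷ true ∷ false ∷ replicate k false
three-step-path k _ = true ∷ true ∷ true ∷ replicate k false

three-step-path-is-snake : ∀ k → Is3Snake (3 + k) 3 (three-step-path k)
three-step-path-is-snake k = steps , far
  where
  steps : ∀ t → t < 3 → Adjacent (three-step-path k t) (three-step-path k (suc t))
  steps 0 _ = cong suc (dist-refl (replicate k false))
  steps 1 _ = cong suc (dist-refl (replicate k false))
  steps 2 _ = cong suc (dist-refl (replicate k false))
  steps (suc (suc (suc _))) (s≤s (s≤s (s≤s ())))
  far : ∀ t t' → t + 3 ≤ t' → t' ≤ 3 → 3 ≤ dist (three-step-path k t) (three-step-path k t')
  far zero 3 _ _ = s≤s (s≤s (s≤s z≤n))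
  far zero (suc (suc (suc (suc _)))) _ (s≤s (s≤s (s≤s ())))
  far zero 0 ()
  far zero 1 (s≤s ())
  far zero 2 (s≤s (s≤s ()))
  far (suc t) t' t+4≤t' t'≤3 = ⊥-elim (1+n≰n (≤-trans (s≤s (m≤n+m 3 t)) (≤-trans t+4≤t' t'≤3)))

3≤max-snake-length : ∀ {n s} → 3 ≤ n → IsMaxSnakeLength n s → 3 ≤ s
3≤max-snake-length 3≤n (_ , longest) with m≤n⇒∃[o]m+o≡n 3≤n
... | k , refl = longest 3 (three-step-path k) (three-step-path-is-snake k)

-- Bootstrap percolation

_⊆_ : ∀ {d} → VSet d → VSet d → Set
A ⊆ B = ∀ {v} → A v ≡ true → B v ≡ true

step-fires : ∀ {d} {A : VSet d} {v} → step A v ≡ true → A v ≡ true ⊎ 3 ≤ infectedNbrs A v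
step-fires {A = A} {v} fired with ∨-true {A v} fired
... | inj₁ infected = inj₁ infected
... | inj₂ three = inj₂ (≤ᵇ-sound three)

step-from-count : ∀ {d} {A : VSet d} {v} → 3 ≤ infectedNbrs A v → step A v ≡ true
step-from-count {A = A} {v} three rewrite ≤ᵇ-complete three = ∨-zeroʳ (A v)

step-from-three : ∀ {d} (A : VSet d) v → ThreeTrue (λ i → A (flipAt v i)) → step A v ≡ true
step-from-three A v = step-from-count {A = A} {v} ∘ threeTrue⇒3≤countTrue

step-mono : ∀ {d} {A B : VSet d} → A ⊆ B → step A ⊆ step B
step-mono {A = A} {B} A⊆B {v} fired with step-fires {A = A} fired
... | inj₁ infected rewrite A⊆B infected = refl
... | inj₂ three = step-from-count {A = B} {v} (≤-trans three (countTrue-mono (λ i → A⊆B {flipAt v i})))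

step-grows : ∀ {d} (A : VSet d) → A ⊆ step A
step-grows A infected rewrite infected = refl

iter-grows : ∀ {d} (A : VSet d) {t t'} → t ≤ t' → iter t A ⊆ iter t' A
iter-grows A {t} {t'} t≤t' with m≤n⇒∃[o]m+o≡n t≤t'
... | k , refl = k-steps-later k
  where
  k-steps-later : ∀ k → iter t A ⊆ iter (t + k) A
  k-steps-later zero rewrite +-identityʳ t = λ infected → infected
  k-steps-later (suc k) rewrite +-suc t k = step-grows (iter (t + k) A) ∘ k-steps-later k

all : ∀ {d} → VSet d → Bool
all {zero} A = A []
all {suc d} A = all (A ∘ (true ∷_)) ∧ all (A ∘ (false ∷_))

all-sound : ∀ {d} (A : VSet d) → all A ≡ true → Full A
all-sound {zero} A h [] = h
all-sound {suc d} A h (true ∷ v) = all-sound (A ∘ (true ∷_)) (∧-true-left h) v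
all-sound {suc d} A h (false ∷ v) = all-sound (A ∘ (false ∷_)) (∧-true-right {all (A ∘ (true ∷_))} h) v

all-complete : ∀ {d} (A : VSet d) → Full A → all A ≡ true
all-complete {zero} A full = full []
all-complete {suc d} A full
  rewrite all-complete (A ∘ (true ∷_)) (full ∘ (true ∷_)) = all-complete (A ∘ (false ∷_)) (full ∘ (false ∷_))

full? : ∀ {d} (A : VSet d) → Dec (Full A)
full? A with all A in all-A
... | true = yes (all-sound A all-A)
... | false = no (λ full → contradiction (trans (sym all-A) (all-complete A full)) λ ())

full-later : ∀ {d} (A : VSet d) {t t'} → t ≤ t' → Full (iter t A) → Full (iter t' A)
full-later A t≤t' full v = iter-grows A t≤t' (full v)

percolation-time-exists : ∀ {d} (A : VSet d) t → Full (iter t A) → ∃ (IsPercTime d A)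
percolation-time-exists A zero full = zero , full , λ _ ()
percolation-time-exists A (suc t) full with full? (iter t A)
... | yes full-t = percolation-time-exists A t full-t
... | no ¬full-t = suc t , full , λ t' t'<1+t full-t' → ¬full-t (full-later A (≤-pred t'<1+t) full-t')

not-full⇒percolation-later : ∀ {d} (A : VSet d) {t p} → ¬ Full (iter t A) → IsPercTime d A p → t < p
not-full⇒percolation-later A {t} {p} ¬full (full-p , _) with t <? p
... | yes t<p = t<p
... | no t≮p = contradiction (full-later A (≮⇒≥ t≮p) full-p) ¬full

infectedNbrs-++ : ∀ m {n} (A : VSet (m + n)) (y : Vertex m) (x : Vertex n) →
  infectedNbrs A (y ++ x) ≡ countTrue (λ i → A (flipAt y i ++ x)) + countTrue (λ j → A (y ++ flipAt x j))
infectedNbrs-++ m A y x = trans (countTrue-++ m (λ k → A (flipAt (y ++ x) k)))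
  (cong₂ _+_ (countTrue-cong (λ i → cong A (flipAt-↑ˡ y x i))) (countTrue-cong (λ j → cong A (flipAt-↑ʳ y x j))))

-- The gadget on Q_10

RankTree : ℕ → Set
RankTree zero = ℕ
RankTree (suc m) = RankTree m × RankTree m

lookupRank : ∀ {m} → RankTree m → Vertex m → ℕ
lookupRank r [] = r
lookupRank (l , _) (true ∷ y) = lookupRank l y
lookupRank (_ , r) (false ∷ y) = lookupRank r y

-- rank y bounds the time, counted from the moment the row e₂₃ × Q_n is full, at which the row
-- y × Q_n is full: rows of rank 0 are infected from the start, and every other row except
-- e₂₃ has three neighbours of smaller rank (rank-cases). A leaf is reached by going left on
-- true and right on false, first coordinate first.
rankTable : RankTree 10
rankTable = ((((((((((17 , 16) , (18 , 17)) , ((16 , 15) , (17 , 16))) , (((16 , 15) , (0 , 0)) , ((15 , 14) , (14 , 13)))) , ((((16 , 15) , (17 , 16)) , ((17 , 16) , (18 , 17))) , (((15 , 14) , (0 , 0)) , ((16 , 15) , (15 , 14))))) , (((((16 , 15) , (17 , 16)) , ((17 , 16) , (18 , 17))) , (((15 , 14) , (0 , 0)) , ((16 , 15) , (15 , 14)))) , ((((15 , 14) , (16 , 15)) , ((16 , 15) , (17 , 16))) , (((14 , 13) , (0 , 0)) , ((15 , 14) , (16 , 15)))))) , ((((((16 , 15) , (17 , 16)) , ((15 , 14) , (16 , 15))) , (((15 , 14) , (10 , 9)) , ((14 , 13) , (13 , 12)))) , ((((15 , 14) , (16 , 15)) , ((16 , 15) , (17 , 16))) , (((14 , 13) , (11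 , 10)) , ((15 , 14) , (14 , 13))))) , (((((15 , 14) , (16 , 15)) , ((16 , 15) , (17 , 16))) , (((14 , 13) , (0 , 8)) , ((15 , 14) , (14 , 13)))) , ((((14 , 13) , (15 , 14)) , ((15 , 14) , (16 , 15))) , (((13 , 12) , (0 , 9)) , ((14 , 13) , (15 , 14))))))) , (((((((14 , 13) , (19 , 18)) , ((0 , 0) , (18 , 17))) , (((15 , 14) , (16 , 15)) , ((0 , 0) , (17 , 16)))) , ((((13 , 12) , (18 , 17)) , ((12 , 11) , (19 , 18))) , (((14 , 13) , (15 , 14)) , ((13 , 12) , (16 , 15))))) , (((((13 , 12) , (18 , 17)) , ((0 , 0) , (19 , 18))) , (((14 , 13) , (0 , 14)) , ((0 , 0) , (16 , 15)))) , ((((12 , 11) , (17 , 16)) , ((11 , 10) , (18 , 17))) , (((13 , 12) , (0 , 13)) , ((12 , 11) , (17 , 16)))))) , ((((((13 , 12) , (18 , 17)) , ((0 , 0) , (17 , 16))) , (((14 , 13) , (15 , 14)) , ((0 , 0) , (16 , 15)))) , ((((12 , 11) , (17 , 16)) , ((11 , 10) , (18 , 17))) , (((13 , 12) , (14 , 13)) , ((12 , 11) , (15 , 14))))) , (((((12 , 11) , (17 , 16)) , ((0 , 0) , (18 , 17))) , (((13 , 12) , (0 , 13)) , ((0 , 0) , (15 , 14)))) , ((((0 , 10) , (16 , 15)) , ((0 , 9) , (17 , 16))) , (((12 , 11) , (0 , 12)) , ((11 , 10) , (16 , 15)))))))) , ((((((((16 , 15) , (17 , 16)) , ((15 , 14)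 , (16 , 15))) , (((15 , 14) , (0 , 0)) , ((14 , 13) , (13 , 12)))) , ((((15 , 14) , (16 , 15)) , ((16 , 15) , (17 , 16))) , (((14 , 13) , (0 , 0)) , ((15 , 14) , (14 , 13))))) , (((((15 , 14) , (16 , 15)) , ((16 , 15) , (17 , 16))) , (((14 , 13) , (0 , 0)) , ((15 , 14) , (14 , 13)))) , ((((14 , 13) , (15 , 14)) , ((15 , 14) , (16 , 15))) , (((13 , 12) , (0 , 0)) , ((14 , 13) , (15 , 14)))))) , ((((((15 , 14) , (16 , 15)) , ((14 , 13) , (15 , 14))) , (((14 , 13) , (11 , 10)) , ((13 , 12) , (0 , 11)))) , ((((14 , 13) , (15 , 14)) , ((15 , 14) , (16 , 15))) , (((13 , 12) , (12 , 11)) , ((14 , 13) , (13 , 12))))) , (((((14 , 13) , (15 , 14)) , ((15 , 14) , (16 , 15))) , (((13 , 12) , (10 , 9)) , ((14 , 13) , (13 , 12)))) , ((((13 , 12) , (14 , 13)) , ((14 , 13) , (15 , 14))) , (((12 , 11) , (11 , 10)) , ((13 , 12) , (14 , 13))))))) , (((((((13 , 12) , (18 , 17)) , ((0 , 0) , (17 , 18))) , (((14 , 13) , (15 , 16)) , ((0 , 0) , (16 , 17)))) , ((((12 , 11) , (17 , 16)) , ((11 , 10) , (18 , 17))) , (((13 , 12) , (14 , 15)) , ((12 , 11) , (15 , 16))))) , (((((12 , 11) , (17 , 16)) , ((0 , 0) , (18 , 17))) , (((13 , 12) , (14 , 15)) , ((0 , 0) , (15 , 16)))) , ((((11 , 10)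 , (16 , 15)) , ((10 , 9) , (17 , 16))) , (((12 , 11) , (13 , 14)) , ((11 , 10) , (16 , 15)))))) , ((((((12 , 11) , (17 , 16)) , ((0 , 0) , (16 , 17))) , (((13 , 12) , (14 , 15)) , ((0 , 0) , (15 , 16)))) , ((((11 , 10) , (16 , 15)) , ((10 , 9) , (17 , 16))) , (((12 , 11) , (13 , 14)) , ((11 , 10) , (14 , 15))))) , (((((11 , 10) , (16 , 15)) , ((0 , 0) , (17 , 16))) , (((12 , 11) , (13 , 14)) , ((0 , 0) , (14 , 15)))) , ((((0 , 9) , (15 , 14)) , ((0 , 8) , (16 , 15))) , (((11 , 10) , (12 , 13)) , ((10 , 9) , (15 , 14))))))))) , (((((((((16 , 0) , (17 , 0)) , ((15 , 0) , (16 , 0))) , (((15 , 0) , (0 , 0)) , ((14 , 0) , (13 , 0)))) , ((((15 , 0) , (16 , 0)) , ((16 , 0) , (17 , 0))) , (((14 , 0) , (0 , 0)) , ((15 , 0) , (14 , 0))))) , (((((15 , 6) , (16 , 7)) , ((16 , 5) , (17 , 6))) , (((14 , 5) , (0 , 0)) , ((15 , 4) , (14 , 3)))) , ((((14 , 7) , (15 , 8)) , ((15 , 6) , (16 , 7))) , (((13 , 6) , (0 , 0)) , ((14 , 5) , (15 , 2)))))) , ((((((15 , 0) , (16 , 0)) , ((14 , 0) , (15 , 0))) , (((14 , 0) , (9 , 0)) , ((13 , 0) , (12 , 0)))) , ((((14 , 0) , (15 , 0)) , ((15 , 0) , (16 , 0))) , (((13 , 0) , (10 , 0)) , ((14 ,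 0) , (13 , 0))))) , (((((14 , 7) , (15 , 8)) , ((15 , 6) , (16 , 7))) , (((13 , 6) , (8 , 7)) , ((14 , 5) , (13 , 6)))) , ((((13 , 8) , (14 , 9)) , ((14 , 7) , (15 , 8))) , (((12 , 7) , (9 , 8)) , ((13 , 6) , (14 , 7))))))) , (((((((13 , 12) , (18 , 17)) , ((0 , 0) , (17 , 18))) , (((14 , 13) , (15 , 16)) , ((0 , 0) , (16 , 17)))) , ((((12 , 11) , (17 , 16)) , ((11 , 10) , (18 , 17))) , (((13 , 12) , (14 , 15)) , ((12 , 11) , (15 , 16))))) , (((((12 , 11) , (17 , 16)) , ((0 , 0) , (18 , 17))) , (((13 , 12) , (14 , 15)) , ((0 , 0) , (15 , 16)))) , ((((11 , 10) , (16 , 15)) , ((10 , 9) , (17 , 16))) , (((12 , 11) , (13 , 14)) , ((11 , 10) , (16 , 15)))))) , ((((((12 , 11) , (17 , 16)) , ((0 , 0) , (16 , 17))) , (((13 , 12) , (14 , 15)) , ((0 , 0) , (15 , 16)))) , ((((11 , 10) , (16 , 15)) , ((10 , 9) , (17 , 16))) , (((12 , 11) , (13 , 14)) , ((11 , 10) , (14 , 15))))) , (((((11 , 10) , (16 , 15)) , ((0 , 0) , (17 , 16))) , (((12 , 11) , (13 , 14)) , ((0 , 0) , (14 , 15)))) , ((((0 , 9) , (15 , 14)) , ((0 , 8) , (16 , 15))) , (((11 , 10) , (12 , 13)) , ((10 , 9) , (15 , 14)))))))) , ((((((((15 , 0) , (16 , 0)) , ((14 , 0) , (15 , 0))) ,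 (((14 , 0) , (0 , 0)) , ((13 , 0) , (12 , 0)))) , ((((14 , 0) , (15 , 0)) , ((15 , 0) , (16 , 0))) , (((13 , 0) , (0 , 0)) , ((14 , 0) , (13 , 0))))) , (((((14 , 5) , (15 , 6)) , ((15 , 4) , (16 , 5))) , (((13 , 4) , (0 , 0)) , ((14 , 3) , (13 , 2)))) , ((((13 , 6) , (14 , 7)) , ((14 , 5) , (15 , 6))) , (((12 , 5) , (0 , 0)) , ((13 , 4) , (14 , 1)))))) , ((((((14 , 0) , (15 , 0)) , ((13 , 0) , (14 , 0))) , (((13 , 0) , (10 , 0)) , ((12 , 0) , (11 , 0)))) , ((((13 , 0) , (14 , 0)) , ((14 , 0) , (15 , 0))) , (((12 , 0) , (11 , 0)) , ((13 , 0) , (12 , 0))))) , (((((13 , 6) , (14 , 7)) , ((14 , 5) , (15 , 6))) , (((12 , 5) , (9 , 6)) , ((13 , 4) , (12 , 5)))) , ((((12 , 7) , (13 , 8)) , ((13 , 6) , (14 , 7))) , (((11 , 6) , (10 , 7)) , ((12 , 5) , (13 , 6))))))) , (((((((12 , 11) , (17 , 18)) , ((0 , 0) , (18 , 19))) , (((13 , 12) , (16 , 17)) , ((0 , 0) , (17 , 18)))) , ((((11 , 10) , (16 , 17)) , ((10 , 9) , (17 , 18))) , (((12 , 11) , (15 , 16)) , ((11 , 10) , (16 , 17))))) , (((((11 , 10) , (16 , 17)) , ((0 , 0) , (17 , 18))) , (((12 , 11) , (15 , 16)) , ((0 , 0) , (16 , 17)))) , ((((10 , 9) , (15 , 16)) ,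 ((9 , 8) , (16 , 17))) , (((11 , 10) , (14 , 15)) , ((10 , 9) , (15 , 16)))))) , ((((((11 , 10) , (16 , 17)) , ((0 , 0) , (17 , 18))) , (((12 , 11) , (15 , 16)) , ((0 , 0) , (16 , 17)))) , ((((10 , 9) , (15 , 16)) , ((9 , 8) , (16 , 17))) , (((11 , 10) , (14 , 15)) , ((10 , 9) , (15 , 16))))) , (((((10 , 9) , (15 , 16)) , ((0 , 0) , (16 , 17))) , (((11 , 10) , (14 , 15)) , ((0 , 0) , (15 , 16)))) , ((((0 , 8) , (14 , 15)) , ((0 , 7) , (15 , 16))) , (((10 , 9) , (13 , 14)) , ((9 , 8) , (14 , 15))))))))))

rank : Vertex 10 → ℕ
rank = lookupRank rankTable

maxRank : ℕ
maxRank = 19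

origin e₀ e₁ e₀₂ e₂ e₂₃ : Vertex 10
origin = replicate 10 false
e₀ = flipAt origin (# 0)
e₁ = flipAt origin (# 1)
e₀₂ = flipAt e₀ (# 2)
e₂ = flipAt origin (# 2)
e₂₃ = flipAt e₂ (# 3)

-- The initial set and its envelopes are unions of (parts of) rows: solid rows entirely, rails
-- on the snake, the runner on the prefix S 0, …, S t, the trigger at S T.
data Role : Set where
  solid rail runner trigger void : Role

role : Vertex 10 → Role
role y =
  if rank y ≡ᵇ 0 then solid
  else if does (y ≟ᵛ origin) then runner
  else if does (y ≟ᵛ e₀) ∨ does (y ≟ᵛ e₁) then rail
  else if does (y ≟ᵛ e₀₂) then trigger
  else void

member : Role → (onSnake onPrefix isEnd : Bool) → Bool
member solid _ _ _ = true
member rail onSnake _ _ = onSnake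
member runner _ onPrefix _ = onPrefix
member trigger _ _ isEnd = isEnd
member void _ _ _ = false

snakewardBound : Role → (onSnake : Bool) → ℕ
snakewardBound solid _ = 0
snakewardBound rail _ = 2
snakewardBound runner onSnake = if onSnake then 0 else 2
snakewardBound trigger _ = 1
snakewardBound void _ = 0

consistent : (onSnake onPrefix isEnd : Bool) → Bool
consistent onSnake onPrefix isEnd = (not isEnd ∨ onSnake) ∧ (not onPrefix ∨ onSnake) ∧ not (onPrefix ∧ isEnd)

gadgetNeighbours : Vertex 10 → (onSnake onPrefix isEnd : Bool) → ℕ
gadgetNeighbours y onSnake onPrefix isEnd = countTrue (λ i → member (role (flipAt y i)) onSnake onPrefix isEnd)

-- The flags describe x: on the snake, on S 0 … S t, on S 0 … S (t + 1), equal to S T. If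
-- (y , x) is outside the envelope at time t + 1, it has at most two neighbours in the envelope at
-- time t: those along Q_10 are counted exactly, those along Q_n are at most snakewardBound.
localRule : Vertex 10 → Vertex 4 → Bool
localRule y (onSnake ∷ onPrefix ∷ onNextPrefix ∷ isEnd ∷ []) =
  not (consistent onSnake onPrefix isEnd) ∨ member (role y) onSnake onNextPrefix isEnd ∨
  (gadgetNeighbours y onSnake onPrefix isEnd + snakewardBound (role y) onSnake ≤ᵇ 2)

rankRule : Vertex 10 → Bool
rankRule y = (rank y ≡ᵇ 0) ∨ does (y ≟ᵛ e₂₃) ∨ (3 ≤ᵇ countTrue (λ i → rank (flipAt y i) <ᵇ rank y))

local-rule-holds : ∀ y → Full (localRule y)
local-rule-holds y = all-sound (localRule y) (all-sound (λ y → all (localRule y)) refl y)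

rank-cases : ∀ y → rank y ≡ 0 ⊎ y ≡ e₂₃ ⊎ ThreeTrue (λ i → rank (flipAt y i) <ᵇ rank y)
rank-cases y =
  Sum.map rank≡0
    (Sum.map (does-true (y ≟ᵛ e₂₃)) (3≤countTrue⇒threeTrue _ ∘ ≤ᵇ-sound) ∘ ∨-true {does (y ≟ᵛ e₂₃)})
    (∨-true {rank y ≡ᵇ 0} (all-sound rankRule refl y))
  where
  rank≡0 : (rank y ≡ᵇ 0) ≡ true → rank y ≡ 0
  rank≡0 h = ≡ᵇ⇒≡ (rank y) 0 (Equivalence.from T-≡ h)

rank≤maxRank : ∀ y → rank y ≤ maxRank
rank≤maxRank y = ≤ᵇ-sound (all-sound (λ y → rank y ≤ᵇ maxRank) refl y)

role-of-rank-0 : ∀ y → rank y ≡ 0 → role y ≡ solid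
role-of-rank-0 y rank≡0 rewrite rank≡0 = refl

member-mono : ∀ r onSnake {onPrefix onPrefix′} isEnd → (onPrefix ≡ true → onPrefix′ ≡ true) →
  member r onSnake onPrefix isEnd ≡ true → member r onSnake onPrefix′ isEnd ≡ true
member-mono solid _ _ _ inside = inside
member-mono rail _ _ _ inside = inside
member-mono runner _ _ grows inside = grows inside
member-mono trigger _ _ _ inside = inside
member-mono void _ _ _ ()

local-rule-bound : ∀ y onSnake onPrefix onNextPrefix isEnd → consistent onSnake onPrefix isEnd ≡ true →
  member (role y) onSnake onNextPrefix isEnd ≡ false →
  gadgetNeighbours y onSnake onPrefix isEnd + snakewardBound (role y) onSnake ≤ 2
local-rule-bound y onSnake onPrefix onNextPrefix isEnd c outside =
  ≤ᵇ-sound (resolve c outside (local-rule-holds y (onSnake ∷ onPrefix ∷ onNextPrefix ∷ isEnd ∷ [])))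
  where
  resolve : ∀ {a b c} → a ≡ true → b ≡ false → not a ∨ b ∨ c ≡ true → c ≡ true
  resolve refl refl h = h

-- The slow percolating set

module Construction {n T : ℕ} (S : ℕ → Vertex n) (snake : Is3Snake n T S) (3≤T : 3 ≤ T) where
  open Snake S snake

  isEnd : Vertex n → Bool
  isEnd x = does (x ≟ᵛ S T)

  envelope : ℕ → VSet (10 + n)
  envelope t v = member (role (take 10 v)) (onPrefix T (drop 10 v)) (onPrefix t (drop 10 v)) (isEnd (drop 10 v))

  A₀ : VSet (10 + n)
  A₀ = envelope 0

  envelope-++ : ∀ t y x → envelope t (y ++ x) ≡ member (role y) (onPrefix T x) (onPrefix t x) (isEnd x)
  envelope-++ t y x =
    cong₂ (λ y′ x′ → member (role y′) (onPrefix T x′) (onPrefix t x′) (isEnd x′)) (take-++ y x) (drop-++ y x)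

  envelope-grows : ∀ t → envelope t ⊆ envelope (suc t)
  envelope-grows t {v} = member-mono (role (take 10 v)) _ _ (onPrefix-mono (n≤1+n t) (drop 10 v))

  flags-consistent : ∀ {t} → t < T → ∀ x → consistent (onPrefix T x) (onPrefix t x) (isEnd x) ≡ true
  flags-consistent {t} t<T x =
    ∧-true (⇒-true end-on-snake) (∧-true (⇒-true (onPrefix-mono (<⇒≤ t<T) x)) (nand-true end-not-on-prefix))
    where
    end-on-snake : isEnd x ≡ true → onPrefix T x ≡ true
    end-on-snake end =
      subst (λ z → onPrefix T z ≡ true) (sym (does-true (x ≟ᵛ S T) end)) (onPrefix-complete T ≤-refl)
    end-not-on-prefix : onPrefix t x ≡ true → isEnd x ≡ true → ⊥
    end-not-on-prefix on end with onPrefix-sound t on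
    ... | u , u≤t , Su≡x = end-not-earlier 3≤T (≤-<-trans u≤t t<T) (trans Su≡x (does-true (x ≟ᵛ S T) end))

  snakeward-neighbours : ∀ {t} → t < T → ∀ y x →
    member (role y) (onPrefix T x) (onPrefix (suc t) x) (isEnd x) ≡ false →
    countTrue (λ j → envelope t (y ++ flipAt x j)) ≤ snakewardBound (role y) (onPrefix T x)
  snakeward-neighbours {t} t<T y x outside =
    ≤-trans (≤-reflexive (countTrue-cong (λ j → envelope-++ t y (flipAt x j)))) (by-role (role y) outside)
    where
    by-role : ∀ r → member r (onPrefix T x) (onPrefix (suc t) x) (isEnd x) ≡ false →
      countTrue (λ j → member r (onPrefix T (flipAt x j)) (onPrefix t (flipAt x j)) (isEnd (flipAt x j)))
        ≤ snakewardBound r (onPrefix T x)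
    by-role solid ()
    by-role rail _ = snake-neighbours≤2 x
    by-role runner off-next-prefix with onPrefix T x in on-snake
    ... | false = ≤-trans (countTrue-mono (λ j → onPrefix-mono (<⇒≤ t<T) (flipAt x j))) (snake-neighbours≤2 x)
    ... | true with onPrefix-sound T on-snake
    ...   | u , u≤T , Su≡x =
      ≤-reflexive (countTrue-none (λ j → subst (λ z → onPrefix t (flipAt z j) ≡ false) Su≡x
        (later-vertex-off-prefix-neighbours t+2≤u u≤T j)))
      where
      t+2≤u : suc (suc t) ≤ u
      t+2≤u with suc (suc t) ≤? u
      ... | yes le = le
      ... | no ≰ = contradiction
        (trans (sym off-next-prefix)
          (subst (λ z → onPrefix (suc t) z ≡ true) Su≡x (onPrefix-complete u (≤-pred (≰⇒> ≰)))))
        λ ()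
    by-role trigger _ =
      countTrue-≤1 (λ i j end-i end-j → flipAt-injective x
        (trans (does-true (flipAt x i ≟ᵛ S T) end-i) (sym (does-true (flipAt x j ≟ᵛ S T) end-j))))
    by-role void _ = ≤-reflexive (countTrue-none {n} {λ _ → false} (λ _ → refl))

  crowded⇒inside : ∀ {t} → t < T → ∀ v → 3 ≤ infectedNbrs (envelope t) v → envelope (suc t) v ≡ true
  crowded⇒inside {t} t<T = ++-split 10 crowded
    where
    crowded : ∀ y x → 3 ≤ infectedNbrs (envelope t) (y ++ x) → envelope (suc t) (y ++ x) ≡ true
    crowded y x three with member (role y) (onPrefix T x) (onPrefix (suc t) x) (isEnd x) in membership
    ... | true = trans (envelope-++ (suc t) y x) membership
    ... | false = ⊥-elim (≤⇒≯ few three)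
      where
      open ≤-Reasoning
      few : infectedNbrs (envelope t) (y ++ x) ≤ 2
      few = begin
        infectedNbrs (envelope t) (y ++ x)
          ≡⟨ infectedNbrs-++ 10 (envelope t) y x ⟩
        countTrue (λ i → envelope t (flipAt y i ++ x)) + countTrue (λ j → envelope t (y ++ flipAt x j))
          ≤⟨ +-mono-≤ (≤-reflexive (countTrue-cong (λ i → envelope-++ t (flipAt y i) x)))
                      (snakeward-neighbours t<T y x membership) ⟩
        gadgetNeighbours y (onPrefix T x) (onPrefix t x) (isEnd x) + snakewardBound (role y) (onPrefix T x)
          ≤⟨ local-rule-bound y (onPrefix T x) (onPrefix t x) (onPrefix (suc t) x) (isEnd x)
               (flags-consistent t<T x) membership ⟩
        2 ∎

  envelope-closed : ∀ {t} → t < T → step (envelope t) ⊆ envelope (suc t)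
  envelope-closed {t} t<T {v} fired =
    [ envelope-grows t {v} , crowded⇒inside t<T v ]′ (step-fires {A = envelope t} {v} fired)

  iter⊆envelope : ∀ {t} → t ≤ T → iter t A₀ ⊆ envelope t
  iter⊆envelope {zero} _ infected = infected
  iter⊆envelope {suc t} t<T {v} infected =
    envelope-closed t<T {v} (step-mono {A = iter t A₀} {envelope t} (iter⊆envelope (<⇒≤ t<T)) {v} infected)

  not-full-at-T : ¬ Full (iter T A₀)
  not-full-at-T full = contradiction (begin
    false                  ≡⟨ sym (envelope-++ T e₂₃ (S T)) ⟩
    envelope T (e₂₃ ++ S T) ≡⟨ iter⊆envelope ≤-refl (full (e₂₃ ++ S T)) ⟩
    true                   ∎) λ ()
    where open ≡-Reasoning

  -- Times are written as neutral terms (T + 2 + k, base + r) and via-gadget receives the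
  -- neighbour through an equation closed by refl, so that the typechecker never unfolds iter.
  InfectedAt : ℕ → Vertex 10 → Vertex n → Set
  InfectedAt t y x = iter t A₀ (y ++ x) ≡ true

  initially : ∀ t y x → A₀ (y ++ x) ≡ true → InfectedAt t y x
  initially t y x = iter-grows A₀ {0} {t} z≤n {y ++ x}

  solid-initially : ∀ t y x → rank y ≡ 0 → InfectedAt t y x
  solid-initially t y x rank≡0 = initially t y x
    (trans (envelope-++ 0 y x) (cong (λ r → member r (onPrefix T x) (onPrefix 0 x) (isEnd x)) (role-of-rank-0 y rank≡0)))

  rail-initially : ∀ t y u → role y ≡ rail → u ≤ T → InfectedAt t y (S u)
  rail-initially t y u is-rail u≤T = initially t y (S u) (trans (envelope-++ 0 y (S u))
    (subst (λ r → member r (onPrefix T (S u)) (onPrefix 0 (S u)) (isEnd (S u)) ≡ true) (sym is-rail)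
      (onPrefix-complete u u≤T)))

  trigger-initially : ∀ t → InfectedAt t e₀₂ (S T)
  trigger-initially t = initially t e₀₂ (S T) (trans (envelope-++ 0 e₀₂ (S T)) (dec-true (S T ≟ᵛ S T) refl))

  via-gadget : ∀ t y x i {y′} → InfectedAt t y′ x → flipAt y i ≡ y′ →
    iter t A₀ (flipAt (y ++ x) (i ↑ˡ n)) ≡ true
  via-gadget t y x i infected refl = subst (λ w → iter t A₀ w ≡ true) (sym (flipAt-↑ˡ y x i)) infected

  via-snake : ∀ t y x j → InfectedAt t y (flipAt x j) → iter t A₀ (flipAt (y ++ x) (10 ↑ʳ j)) ≡ true
  via-snake t y x j = subst (λ w → iter t A₀ w ≡ true) (sym (flipAt-↑ʳ y x j))

  infect : ∀ t y x → ThreeTrue (λ k → iter t A₀ (flipAt (y ++ x) k)) → InfectedAt (suc t) y x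
  infect t y x = step-from-three (iter t A₀) (y ++ x)

  runner-infected : ∀ u → u ≤ T → InfectedAt u origin (S u)
  runner-infected zero _ = trans (envelope-++ 0 origin (S 0)) (onPrefix-complete 0 {0} z≤n)
  runner-infected (suc u) u<T with adjacent⇒flipAt (S (suc u)) (S u) (adjacent-sym (S u) (S (suc u)) (steps u u<T))
  ... | back , back≡ = infect u origin (S (suc u)) record
    { i = # 0 ↑ˡ n ; j = # 1 ↑ˡ n ; k = 10 ↑ʳ back
    ; fi = via-gadget u origin x (# 0) (rail-initially u e₀ (suc u) refl u<T) refl
    ; fj = via-gadget u origin x (# 1) (rail-initially u e₁ (suc u) refl u<T) refl
    ; fk = via-snake u origin x back (subst (InfectedAt u origin) (sym back≡) (runner-infected u (<⇒≤ u<T)))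
    ; i≢j = λ () ; i≢k = λ () ; j≢k = λ () }
    where
    x : Vertex n
    x = S (suc u)

  trigger-fires : InfectedAt (suc T) e₂ (S T)
  trigger-fires = infect T e₂ (S T) record
    { i = # 2 ↑ˡ n ; j = # 0 ↑ˡ n ; k = # 4 ↑ˡ n
    ; fi = via-gadget T e₂ (S T) (# 2) (runner-infected T ≤-refl) refl
    ; fj = via-gadget T e₂ (S T) (# 0) (trigger-initially T) refl
    ; fk = via-gadget T e₂ (S T) (# 4) (solid-initially T (flipAt e₂ (# 4)) (S T) refl) refl
    ; i≢j = λ () ; i≢k = λ () ; j≢k = λ () }

  e₂₃-at-end : InfectedAt (suc (suc T)) e₂₃ (S T)
  e₂₃-at-end = infect (suc T) e₂₃ (S T) record
    { i = # 3 ↑ˡ n ; j = # 4 ↑ˡ n ; k = # 7 ↑ˡ n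
    ; fi = via-gadget (suc T) e₂₃ (S T) (# 3) trigger-fires refl
    ; fj = via-gadget (suc T) e₂₃ (S T) (# 4) (solid-initially (suc T) (flipAt e₂₃ (# 4)) (S T) refl) refl
    ; fk = via-gadget (suc T) e₂₃ (S T) (# 7) (solid-initially (suc T) (flipAt e₂₃ (# 7)) (S T) refl) refl
    ; i≢j = λ () ; i≢k = λ () ; j≢k = λ () }

  e₂₃-row : ∀ k x → dist x (S T) ≡ k → InfectedAt (T + 2 + k) e₂₃ x
  e₂₃-row zero x x≡ST =
    subst₂ (λ t z → InfectedAt t e₂₃ z) (sym (trans (+-identityʳ (T + 2)) (+-comm T 2))) (sym (dist≡0⇒≡ x≡ST))
      e₂₃-at-end
  e₂₃-row (suc k) x dist≡1+k with closer-neighbour x (S T) dist≡1+k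
  ... | closer , closer-dist = subst (λ t → InfectedAt t e₂₃ x) (sym (+-suc (T + 2) k))
    (infect (T + 2 + k) e₂₃ x record
    { i = 10 ↑ʳ closer ; j = # 4 ↑ˡ n ; k = # 7 ↑ˡ n
    ; fi = via-snake (T + 2 + k) e₂₃ x closer (e₂₃-row k (flipAt x closer) closer-dist)
    ; fj = via-gadget (T + 2 + k) e₂₃ x (# 4) (solid-initially (T + 2 + k) (flipAt e₂₃ (# 4)) x refl) refl
    ; fk = via-gadget (T + 2 + k) e₂₃ x (# 7) (solid-initially (T + 2 + k) (flipAt e₂₃ (# 7)) x refl) refl
    ; i≢j = λ () ; i≢k = λ () ; j≢k = λ () })

  base : ℕ
  base = T + 2 + n

  e₂₃-row-full : ∀ x → InfectedAt base e₂₃ x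
  e₂₃-row-full x =
    iter-grows A₀ {T + 2 + dist x (S T)} {base} (+-monoʳ-≤ (T + 2) (dist≤dim x (S T))) (e₂₃-row _ x refl)

  InfectedByRank : ℕ → Set
  InfectedByRank r = ∀ y → rank y ≡ r → ∀ x → InfectedAt (base + r) y x

  infected-from-lower-ranks : ∀ r → (∀ {r′} → r′ < r → InfectedByRank r′) →
    ∀ y x → ThreeTrue (λ i → rank (flipAt y i) <ᵇ r) → InfectedAt (base + r) y x
  infected-from-lower-ranks zero _ _ _ lower = contradiction (ThreeTrue.fi lower) λ ()
  infected-from-lower-ranks (suc r) earlier y x lower =
    subst (λ t → InfectedAt t y x) (sym (+-suc base r))
      (infect (base + r) y x (threeTrue-map (_↑ˡ n) (↑ˡ-injective n _ _) neighbour lower))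
    where
    neighbour : ∀ {i} → (rank (flipAt y i) <ᵇ suc r) ≡ true →
      iter (base + r) A₀ (flipAt (y ++ x) (i ↑ˡ n)) ≡ true
    neighbour {i} lower-i = via-gadget (base + r) y x i
      (iter-grows A₀ (+-monoʳ-≤ base (≤-pred rank<)) {flipAt y i ++ x} (earlier rank< (flipAt y i) refl x)) refl
      where
      rank< : rank (flipAt y i) < suc r
      rank< = <ᵇ⇒< _ _ (Equivalence.from T-≡ lower-i)

  infected-by-rank : ∀ r → InfectedByRank r
  infected-by-rank = <-rec InfectedByRank spread
    where
    spread : ∀ r → (∀ {r′} → r′ < r → InfectedByRank r′) → InfectedByRank r
    spread r earlier y rank≡r x with rank-cases y
    ... | inj₁ rank≡0 = solid-initially (base + r) y x rank≡0
    ... | inj₂ (inj₁ refl) = iter-grows A₀ (m≤m+n base r) {e₂₃ ++ x} (e₂₃-row-full x)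
    ... | inj₂ (inj₂ lower) =
      infected-from-lower-ranks r earlier y x (subst (λ r → ThreeTrue (λ i → rank (flipAt y i) <ᵇ r)) rank≡r lower)

  full : Full (iter (base + maxRank) A₀)
  full = ++-split 10 λ y x →
    iter-grows A₀ (+-monoʳ-≤ base (rank≤maxRank y)) {y ++ x} (infected-by-rank (rank y) y refl x)

  T<max-percolation-time : ∀ {m} → IsMaxPercTime (10 + n) m → T < m
  T<max-percolation-time {m} (_ , slowest) = bound (percolation-time-exists A₀ (base + maxRank) full)
    where
    bound : ∃ (IsPercTime (10 + n) A₀) → T < m
    bound (p , perc) = <-≤-trans (not-full⇒percolation-later A₀ not-full-at-T perc) (slowest A₀ p perc)

snake-length≤percolation-time : ∀ {n s m} → 3 ≤ n → IsMaxSnakeLength n s → IsMaxPercTime (10 + n) m → s ≤ m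
snake-length≤percolation-time 3≤n max-snake@((S , snake) , _) slowest =
  <⇒≤ (Construction.T<max-percolation-time S snake (3≤max-snake-length 3≤n max-snake) slowest)

lemma3p2 : ∀ (d : ℕ) → 15 ≤ d → (∃ λ k → d ≡ suc (2 * k)) →
    ∀ (s m : ℕ) → IsMaxSnakeLength (d ∸ 10) s → IsMaxPercTime d m → s ≤ m
lemma3p2 d 15≤d _ s m longest slowest =
  snake-length≤percolation-time (≤-trans (m≤m+n 3 2) (∸-monoˡ-≤ 10 15≤d)) longest
    (subst (λ d → IsMaxPercTime d m) (sym (m+[n∸m]≡n (≤-trans (m≤m+n 10 5) 15≤d))) slowest)
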